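{- Let $n$ be a positive integer. Then $$p(n)\le p(n-1)+p(n-2)-p(n-5).$$
   Context: $p(n)$ denotes the number of partitions of the positive integer $n$ (unordered representations of $n$ as a sum of positive integers), with the conventions $p(0)=1$ and $p(k)=0$ for $k<0$. -}

module Defs where

open import Data.Nat using (ℕ; zero; suc; _+_; _≤_; _≥_)
open import Data.List using (List; []; _∷_; length; map; concatMap; upTo)
open import Data.Integer using (ℤ; +_; -[1+_])

-- A partition of n is a non-increasing list of positive integers summing to n.
-- Explicit enumeration: parts bounded by b, summing to n, non-increasing.
-- partsLE fuel b n : all non-increasing lists of positive parts ≤ b summing to n.
-- fuel = n suffices (each part is ≥ 1).
partsLE : ℕ → ℕ → ℕ → List (List ℕ)
partsLE _        _ zero    = [] ∷ []
partsLE zero     _ (suc _) = []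
partsLE (suc f)  b (suc m) = concatMap step (upTo (suc b))
  where
  open import Data.Nat using (_∸_; _<ᵇ_)
  open import Data.Bool using (if_then_else_)
  step : ℕ → List (List ℕ)
  step zero = []
  step (suc k) = if suc m <ᵇ suc k then []
                 else map (suc k ∷_) (partsLE f (suc k) (suc m ∸ suc k))

partitions : ℕ → List (List ℕ)
partitions n = partsLE n n n

pℕ : ℕ → ℕ
pℕ n = length (partitions n)

p : ℤ → ℤ
p (+ n) = + pℕ n
p -[1+ _ ] = + 0

module Submission where

-- Let P b z be the number of partitions of the integer z into parts of size
-- at most b (zero for z < 0).  Sorting partitions by whether they use the
-- part b+1 gives the recurrence  P (b+1) z = P b z + P (b+1) (z - (b+1)).
-- Write L b z = P b z + P b (z-5) and R b z = P b (z-1) + P b (z-2); both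
-- obey the same recurrence, and L b 0 = 1, R b 0 = 0, L b z = R b z = 0 for
-- z < 0.  We show by induction on b ≥ 1 that L b z ≤ R b z for all z ≥ 1,
-- with strict inequality on the window b+1 ≤ z ≤ 2b+2.  In the induction
-- step the recurrence splits level b+1 at z into level b at z plus level b+1
-- at z-(b+1) (handled by an inner strong induction on z); the one point
-- z = b+1, where the second summand is the "bad" value L 0 = 1 > R 0, is
-- paid for by strictness at level b.  The base case b = 1 is an explicit
-- computation, since P 1 z = 1 for z ≥ 0.  Finally p(n) = P n n = P B n for
-- any B ≥ n, so taking B = n turns L B n ≤ R B n into the theorem.

open import Defs

module BoundedPartitions where

  open import Data.Nat
  open import Data.Nat.Properties
  open import Data.Nat.Induction using (<-rec)
  open import Data.Integer as ℤ using (ℤ; +_; -[1+_])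
  open import Data.Integer.Properties as ℤ using ()
  open import Data.Bool using (true; false; if_then_else_)
  open import Data.Bool.Properties using (if-float; if-cong-else)
  open import Data.List using (List; []; _∷_; _++_; [_]; length; concatMap; applyUpTo)
  open import Data.List.Properties
    using (length-map; length-++; concatMap-++; applyUpTo-∷ʳ; ++-identityʳ)
  open import Data.Product using (_×_; _,_)
  open import Data.Unit using (tt)
  open import Function using (_∘_)
  open import Relation.Nullary using (yes; no; contradiction)
  open import Relation.Binary.PropositionalEquality hiding ([_])
  open import Algebra.Properties.CommutativeSemigroup +-commutativeSemigroup
    using (interchange)
  open import Algebra.Properties.CommutativeSemigroup ℤ.+-commutativeSemigroup
    using () renaming (xy∙z≈xz∙y to swap-shifts)
  open ≡-Reasoning

  sumBelow : (ℕ → ℕ) → ℕ → ℕ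
  sumBelow g zero    = 0
  sumBelow g (suc n) = sumBelow g n + g n

  sumBelow-cong : ∀ {g h} → (∀ k → g k ≡ h k) → ∀ n → sumBelow g n ≡ sumBelow h n
  sumBelow-cong eq zero    = refl
  sumBelow-cong eq (suc n) = cong₂ _+_ (sumBelow-cong eq n) (eq n)

  length-concatMap : ∀ {A : Set} (h : ℕ → List A) (g : ℕ → ℕ) →
                     (∀ k → length (h (suc k)) ≡ g k) →
                     ∀ n → length (concatMap h (applyUpTo suc n)) ≡ sumBelow g n
  length-concatMap h g eq zero    = refl
  length-concatMap h g eq (suc n) = begin
      length (concatMap h (applyUpTo suc (suc n)))
    ≡⟨ cong (length ∘ concatMap h) (sym (applyUpTo-∷ʳ suc n)) ⟩
      length (concatMap h (applyUpTo suc n ++ [ suc n ]))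
    ≡⟨ cong length (concatMap-++ h (applyUpTo suc n) [ suc n ]) ⟩
      length (concatMap h (applyUpTo suc n) ++ h (suc n) ++ [])
    ≡⟨ length-++ (concatMap h (applyUpTo suc n)) ⟩
      length (concatMap h (applyUpTo suc n)) + length (h (suc n) ++ [])
    ≡⟨ cong₂ _+_ (length-concatMap h g eq n)
                 (trans (cong length (++-identityʳ (h (suc n)))) (eq n)) ⟩
      sumBelow g n + g n
    ∎

  -- count f b n is the length of  partsLE f b n , computed by the same
  -- recursion: a partition of m+1 is a first (largest) part k+1 ≤ b followed
  -- by a partition of m-k into parts ≤ k+1; withFirstPart f m k counts those.
  mutual
    count : ℕ → ℕ → ℕ → ℕ
    count _       _ zero    = 1
    count zero    _ (suc _) = 0
    count (suc f) b (suc m) = sumBelow (withFirstPart f m) b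

    withFirstPart : ℕ → ℕ → ℕ → ℕ
    withFirstPart f m k = if m <ᵇ k then 0 else count f (suc k) (m ∸ k)

  length-partsLE : ∀ f b n → length (partsLE f b n) ≡ count f b n
  length-partsLE f       b zero    = refl
  length-partsLE zero    b (suc m) = refl
  length-partsLE (suc f) b (suc m) = length-concatMap _ (withFirstPart f m)
    (λ k → trans (if-float length (m <ᵇ k))
                 (if-cong-else (m <ᵇ k) (trans (length-map (suc k ∷_) (partsLE f (suc k) (m ∸ k)))
                                               (length-partsLE f (suc k) (m ∸ k)))))
    b

  count-fuel : ∀ f b n → n ≤ f → count (suc f) b n ≡ count f b n
  count-fuel f       b zero    _         = refl
  count-fuel (suc f) b (suc m) (s≤s m≤f) = sumBelow-cong same-parts b
    where
    same-parts : ∀ k → withFirstPart (suc f) m k ≡ withFirstPart f m k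
    same-parts k =
      if-cong-else (m <ᵇ k) (count-fuel f (suc k) (m ∸ k) (≤-trans (m∸n≤m m k) m≤f))

  Q : ℕ → ℕ → ℕ
  Q b n = count n b n

  count-stable : ∀ {f} b n → n ≤′ f → count f b n ≡ Q b n
  count-stable b n ≤′-refl        = refl
  count-stable b n (≤′-step n≤′f) = trans (count-fuel _ b n (≤′⇒≤ n≤′f)) (count-stable b n n≤′f)

  withFirstPart-small : ∀ {f m k} → m < k → withFirstPart f m k ≡ 0
  withFirstPart-small {m = m} {k} m<k with m <ᵇ k | <⇒<ᵇ m<k
  ... | true | _ = refl

  withFirstPart-large : ∀ {f m k} → k ≤ m → withFirstPart f m k ≡ count f (suc k) (m ∸ k)
  withFirstPart-large {m = m} {k} k≤m with m <ᵇ k | <ᵇ⇒< m k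
  ... | true  | m<k = contradiction (m<k tt) (≤⇒≯ k≤m)
  ... | false | _   = refl

  P : ℕ → ℤ → ℕ
  P b (+ n)    = Q b n
  P b -[1+ _ ] = 0

  P-below : ∀ b {m n} → m < n → P b (+ m ℤ.- + n) ≡ 0
  P-below b {m} {n} m<n =
    trans (cong (P b) (trans (ℤ.[+m]-[+n]≡m⊖n m n) (ℤ.⊖-< m<n))) (P-negated (m<n⇒0<n∸m m<n))
    where
    P-negated : ∀ {j} → 0 < j → P b (ℤ.- + j) ≡ 0
    P-negated {suc j} _ = refl

  P-above : ∀ b {m n} → n ≤ m → P b (+ m ℤ.- + n) ≡ Q b (m ∸ n)
  P-above b {m} {n} n≤m = cong (P b) (trans (ℤ.[+m]-[+n]≡m⊖n m n) (ℤ.⊖-≥ n≤m))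

  withFirstPart-as-P : ∀ b m → withFirstPart m m b ≡ P (suc b) (+ suc m ℤ.- + suc b)
  withFirstPart-as-P b m with m <? b
  ... | yes m<b = trans (withFirstPart-small m<b) (sym (P-below (suc b) (s≤s m<b)))
  ... | no  m≮b = begin
      withFirstPart m m b      ≡⟨ withFirstPart-large (≮⇒≥ m≮b) ⟩
      count m (suc b) (m ∸ b)  ≡⟨ count-stable (suc b) (m ∸ b) (≤⇒≤′ (m∸n≤m m b)) ⟩
      Q (suc b) (m ∸ b)        ≡⟨ P-above (suc b) (s≤s (≮⇒≥ m≮b)) ⟨
      P (suc b) (+ suc m ℤ.- + suc b)
    ∎

  -- Main recurrence: a partition into parts ≤ b+1 either has no part b+1,
  -- or removing one part b+1 leaves a partition of z-(b+1) into parts ≤ b+1.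
  P-rec : ∀ b z → P (suc b) z ≡ P b z + P (suc b) (z ℤ.- + suc b)
  P-rec b -[1+ _ ]  = refl
  P-rec b (+ zero)  = refl
  P-rec b (+ suc m) = cong (_+_ (Q b (suc m))) (withFirstPart-as-P b m)

  Q-bound : ∀ b n → n ≤ b → Q (suc b) n ≡ Q b n
  Q-bound b n n≤b = begin
    Q (suc b) n                          ≡⟨ P-rec b (+ n) ⟩
    Q b n + P (suc b) (+ n ℤ.- + suc b)  ≡⟨ cong (_+_ (Q b n)) (P-below (suc b) (s≤s n≤b)) ⟩
    Q b n + 0                            ≡⟨ +-identityʳ (Q b n) ⟩
    Q b n                                ∎

  Q-bound-stable : ∀ {b} n → n ≤′ b → Q b n ≡ Q n n
  Q-bound-stable n ≤′-refl        = refl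
  Q-bound-stable n (≤′-step n≤′b) = trans (Q-bound _ n (≤′⇒≤ n≤′b)) (Q-bound-stable n n≤′b)

  Q-one : ∀ n → Q 1 n ≡ 1
  Q-one zero    = refl
  Q-one (suc n) = Q-one n

  twoTerm : ℕ → ℕ → ℕ → ℤ → ℕ
  twoTerm s t b z = P b (z ℤ.- + s) + P b (z ℤ.- + t)

  L R : ℕ → ℤ → ℕ
  L = twoTerm 0 5
  R = twoTerm 1 2

  twoTerm-rec : ∀ s t b z →
                twoTerm s t (suc b) z ≡ twoTerm s t b z + twoTerm s t (suc b) (z ℤ.- + suc b)
  twoTerm-rec s t b z = begin
      P (suc b) (z ℤ.- + s) + P (suc b) (z ℤ.- + t)
    ≡⟨ cong₂ _+_ (P-rec-shifted s) (P-rec-shifted t) ⟩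
      (P b (z ℤ.- + s) + P (suc b) (w ℤ.- + s)) + (P b (z ℤ.- + t) + P (suc b) (w ℤ.- + t))
    ≡⟨ interchange (P b (z ℤ.- + s)) _ _ _ ⟩
      twoTerm s t b z + twoTerm s t (suc b) w
    ∎
    where
    w : ℤ
    w = z ℤ.- + suc b
    P-rec-shifted : ∀ r → P (suc b) (z ℤ.- + r) ≡ P b (z ℤ.- + r) + P (suc b) (w ℤ.- + r)
    P-rec-shifted r =
      trans (P-rec b (z ℤ.- + r)) (cong (_+_ (P b (z ℤ.- + r)) ∘ P (suc b)) (swap-shifts z _ _))

  lift : ∀ (_∼_ : ℕ → ℕ → Set) b z {w} → z ℤ.- + suc b ≡ w →
         (L b z + L (suc b) w) ∼ (R b z + R (suc b) w) → L (suc b) z ∼ R (suc b) z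
  lift _∼_ b z refl = subst₂ _∼_ (sym (twoTerm-rec 0 5 b z)) (sym (twoTerm-rec 1 2 b z))

  excess : ∀ b k → suc (b + k) ∸ b ≡ suc k
  excess b k = trans (cong (_∸ b) (sym (+-suc b k))) (m+n∸m≡n b (suc k))

  shift-below : ∀ m k → + suc m ℤ.- + suc (suc (m + k)) ≡ -[1+ k ]
  shift-below m k = trans (ℤ.[+m]-[+n]≡m⊖n (suc m) (suc (suc (m + k))))
    (trans (ℤ.⊖-< (s≤s (s≤s (m≤m+n m k)))) (cong (ℤ.-_ ∘ +_) (excess m k)))

  shift-self : ∀ m → + suc m ℤ.- + suc m ≡ + 0
  shift-self m = ℤ.n⊖n≡0 (suc m)

  shift-above : ∀ b k → + suc (suc (b + k)) ℤ.- + suc b ≡ + suc k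
  shift-above b k = trans (ℤ.[+m]-[+n]≡m⊖n (suc (suc (b + k))) (suc b))
    (trans (ℤ.⊖-≥ (s≤s (m≤n⇒m≤1+n (m≤m+n b k)))) (cong +_ (excess b k)))

  Weak : ℕ → Set
  Weak b = ∀ m → L b (+ suc m) ≤ R b (+ suc m)

  Strict : ℕ → ℕ → Set
  Strict b m = L b (+ suc m) < R b (+ suc m)

  StrictWindow : ℕ → Set
  StrictWindow b = ∀ m → b ≤ m → m ≤ suc (b + b) → Strict b m

  -- The weak inequality passes from b to b+1, given strictness at z = b+1
  -- to absorb the term L (b+1) 0 = 1 > 0 = R (b+1) 0.
  weak-lift : ∀ {b} → Weak b → Strict b b → Weak (suc b)
  weak-lift {b} weak strict = <-rec _ lift-at
    where
    lift-at : ∀ m → (∀ {k} → k < m → L (suc b) (+ suc k) ≤ R (suc b) (+ suc k)) →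
              L (suc b) (+ suc m) ≤ R (suc b) (+ suc m)
    lift-at m ih with compare m b
    ... | less .m k    = lift _≤_ b (+ suc m) (shift-below m k) (+-monoˡ-≤ 0 (weak m))
    ... | equal .m     = lift _≤_ b (+ suc m) (shift-self m)
                           (subst₂ _≤_ (+-comm 1 _) (sym (+-identityʳ _)) strict)
    ... | greater .b k = lift _≤_ b (+ suc m) (shift-above b k)
                           (+-mono-≤ (weak m) (ih (s≤s (m≤n+m k b))))

  -- Strictness at level b+1 for all z ≥ b+2: near the window it comes from
  -- level b, beyond it from level b+1 at z-(b+1) (inner strong induction).
  strict-lift : ∀ {b} → Weak b → Weak (suc b) → StrictWindow b → ∀ m → b < m → Strict (suc b) m
  strict-lift {b} weak weak′ window = <-rec _ lift-at
    where
    lift-at : ∀ m → (∀ {k} → k < m → b < k → Strict (suc b) k) → b < m → Strict (suc b) m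
    lift-at m ih b<m with m≤n⇒∃[o]m+o≡n b<m
    ... | k , refl with k ≤? b
    ...   | yes k≤b = lift _<_ b (+ suc m) (shift-above b k)
                        (+-mono-≤ (window m (m≤n⇒m≤1+n (m≤m+n b k)) (s≤s (+-monoʳ-≤ b k≤b)))
                                  (weak′ k))
    ...   | no  k≰b = lift _<_ b (+ suc m) (shift-above b k)
                        (subst (_≤ R b (+ suc m) + R (suc b) (+ suc k))
                               (+-suc (L b (+ suc m)) (L (suc b) (+ suc k)))
                               (+-mono-≤ (weak m) (ih (s≤s (m≤n+m k b)) (≰⇒> k≰b))))

  Good : ℕ → Set
  Good b = Weak b × StrictWindow b

  good-suc : ∀ {b} → Good b → Good (suc b)
  good-suc {b} (weak , window) = weak′ , λ m b<m _ → strict-lift weak weak′ window m b<m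
    where
    weak′ : Weak (suc b)
    weak′ = weak-lift weak (window b ≤-refl (m≤n⇒m≤1+n (m≤m+n b b)))

  -- Base case: with parts ≤ 1, L 1 z = 1 + [z ≥ 5] and R 1 z = [z ≥ 1] + [z ≥ 2].
  good-one : Good 1
  good-one = weak-one , window-one
    where
    weak-one : Weak 1
    weak-one 0 = ≤-refl
    weak-one 1 = n≤1+n 1
    weak-one 2 = n≤1+n 1
    weak-one 3 = n≤1+n 1
    weak-one (suc (suc (suc (suc k)))) = ≤-reflexive
      (trans (cong₂ _+_ (Q-one (5 + (k + 0))) (Q-one k))
             (sym (cong₂ _+_ (Q-one (4 + k)) (Q-one (3 + k)))))
    window-one : StrictWindow 1
    window-one 1 _ _ = ≤-refl
    window-one 2 _ _ = ≤-refl
    window-one 3 _ _ = ≤-refl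
    window-one (suc (suc (suc (suc _)))) _ (s≤s (s≤s (s≤s ())))

  good : ∀ b → Good (suc b)
  good zero    = good-one
  good (suc b) = good-suc (good b)

  p-as-P : ∀ {B} z → z ℤ.≤ + B → p z ≡ + P B z
  p-as-P (+ n)    n≤B = cong +_ (trans (length-partsLE n n n)
                                       (sym (Q-bound-stable n (≤⇒≤′ (ℤ.drop‿+≤+ n≤B)))))
  p-as-P -[1+ _ ] _   = refl

  rearrange : ∀ {a b c d} → a + d ≤ b + c → + a ℤ.≤ (+ b ℤ.+ + c) ℤ.- + d
  rearrange {a} {b} {c} {d} a+d≤b+c =
    subst (+ a ℤ.≤_) (sym (trans (ℤ.[+m]-[+n]≡m⊖n (b + c) d) (ℤ.⊖-≥ d≤b+c)))
          (ℤ.+≤+ (m+n≤o⇒m≤o∸n a a+d≤b+c))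
    where
    d≤b+c : d ≤ b + c
    d≤b+c = ≤-trans (m≤n+m d a) a+d≤b+c

open import Data.Nat using (ℕ; suc)
open import Data.Integer using (ℤ; +_; _+_; _-_; _≤_)
open import Data.Integer.Properties using (+-identityʳ; i-j≤i; module ≤-Reasoning)
open import Data.Product using (proj₁)
open import Relation.Binary.PropositionalEquality using (cong; cong₂)
open BoundedPartitions using (P; good; p-as-P; rearrange)

theorem4 : (n : ℕ) → p (+ suc n) ≤ (p (+ suc n - + 1) + p (+ suc n - + 2)) - p (+ suc n - + 5)
theorem4 n = begin
    p z                   ≡⟨ cong p (+-identityʳ z) ⟨
    p (z - + 0)           ≡⟨ p-as-P (z - + 0) (i-j≤i z (+ 0)) ⟩
    + P B (z - + 0)       ≤⟨ rearrange {b = P B (z - + 1)} (proj₁ (good n) n) ⟩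
    (+ P B (z - + 1) + + P B (z - + 2)) - + P B (z - + 5)
      ≡⟨ cong₂ _-_ (cong₂ _+_ (p-as-P (z - + 1) (i-j≤i z (+ 1))) (p-as-P (z - + 2) (i-j≤i z (+ 2))))
                   (p-as-P (z - + 5) (i-j≤i z (+ 5))) ⟨
    (p (z - + 1) + p (z - + 2)) - p (z - + 5)
  ∎
  where
  open ≤-Reasoning
  B : ℕ
  B = suc n
  z : ℤ
  z = + B
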